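{- Suppose $0<1/n\ll\eta\ll1/\ell\ll1$ and let $m=\eta^2n$ be an integer. Let $Z$ be a set of vertices of the reduced grid digraph $G(n;m)$ such that (G1) $|Z|\le\frac1{10}m$, and (G2) for each positive integer $i\le m/\ell$, each of the sets $L(0,i\ell)$ and $L(2n-i\ell,2n)$ contains at most $i-1$ vertices of $Z$. Then $G(n;m)$ contains a directed path from $(0,0)$ to $(n,n)$ that contains no vertex of $Z$.
   Context: The grid digraph $G(n)$ has vertex set $[0,n]\times[0,n]$ and arcs from $(i,j)$ to $(i,j+1)$ and from $(i,j)$ to $(i+1,j)$ (whenever both endpoints are vertices). $G(n;m)$ is the subgraph of $G(n)$ induced by the vertices $(i,j)$ with $|i-j|\le m$. For $s$, $L_s$ is the set of vertices $(i,j)$ of $G(n;m)$ with $i+j=s$, and $L(s,t)=\bigcup_{s\le j\le t}L_j$. The hierarchy means $\ell$ is sufficiently large, $\eta$ sufficiently small in terms of $\ell$, and $n$ sufficiently large in terms of $\eta$. -}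

module Defs where

open import Data.Nat using (ℕ; zero; suc; _+_; _*_; _∸_; _≤_; _<_; _≤?_)
open import Data.Product using (_×_; _,_)
open import Data.Sum using (_⊎_)
open import Data.List using (List; []; _∷_; length; filter)
open import Relation.Binary.PropositionalEquality using (_≡_)

Vertex : Set
Vertex = ℕ × ℕ

InGrid : ℕ → ℕ → Vertex → Set
InGrid n m (i , j) = (i ≤ n) × (j ≤ n) × (i ∸ j ≤ m) × (j ∸ i ≤ m)

Arc : Vertex → Vertex → Set
Arc (i , j) (i' , j') = ((i' ≡ i) × (j' ≡ suc j)) ⊎ ((i' ≡ suc i) × (j' ≡ j))

data IsPathFromTo (n m : ℕ) : Vertex → Vertex → List Vertex → Set where
  single : ∀ {v} → InGrid n m v → IsPathFromTo n m v v (v ∷ [])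
  step   : ∀ {u v w p} → InGrid n m u → Arc u v → IsPathFromTo n m v w p →
           IsPathFromTo n m u w (u ∷ p)

level : Vertex → ℕ
level (i , j) = i + j

countLow : ℕ → List Vertex → ℕ
countLow t Z = length (filter (λ v → level v ≤? t) Z)

-- number of vertices of Z in L(s,2n)  (levels ≥ s; levels ≤ 2n hold automatically in the grid)
countHigh : ℕ → List Vertex → ℕ
countHigh s Z = length (filter (λ v → s ≤? level v) Z)

module Submission where

open import Defs
open import Data.Nat using (ℕ; zero; suc; _+_; _*_; _∸_; _≤_; _<_; z≤n; s≤s; s≤s⁻¹; _≤′_; ≤′-refl; ≤′-step; _≤?_; _<?_; ⌈_/2⌉; NonZero; >-nonZero; >-nonZero⁻¹)
open import Data.Nat.Properties
open import Data.Nat.DivMod using (_%_; m/n≤m; m/n*n≤m; m≡m%n+[m/n]*n; m%n<n) renaming (_/_ to _div_)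
open import Data.Integer as ℤ using (+_; -[1+_])
open import Data.Integer.Properties as ℤ using (drop‿+<+; drop‿+≤+; pos-*)
open import Data.Rational using (ℚ; mkℚ; 0ℚ; 1ℚ; ↥_; ↧_; ↧ₙ_; toℚᵘ; _/_) renaming (_*_ to _*ℚ_; _≤_ to _≤ℚ_; _<_ to _<ℚ_)
open import Data.Rational.Properties using (drop-*<*; drop-*≤*; toℚᵘ-homo-*; toℚᵘ-fromℚᵘ; positive⁻¹)
open import Data.Rational.Unnormalised using (mkℚᵘ; *≡*)
open import Data.Rational.Unnormalised.Properties using (≃-trans; ≃-sym; ≃-reflexive; *-congˡ)
open import Data.Product using (Σ; ∃-syntax; _×_; _,_; proj₁; proj₂; uncurry)
open import Data.Product.Properties using (≡-dec)
open import Data.Sum using (_⊎_; inj₁; inj₂)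
open import Data.Empty using (⊥-elim)
open import Data.Unit using (tt)
open import Data.List using (List; []; _∷_; _++_; length; filter)
open import Data.List.Properties using (length-filter)
open import Data.List.Relation.Unary.All using (All; []; _∷_)
import Data.List.Relation.Unary.All.Properties as All
open import Data.List.Relation.Unary.Any using (here; there)
open import Data.List.Relation.Unary.Unique.Propositional using (Unique)
open import Data.List.Membership.Propositional using (_∈_; _∉_)
open import Data.List.Membership.Propositional.Properties using (∈-filter⁺)
open import Function using (_∘_; id)
open import Level using (0ℓ)
open import Relation.Nullary using (Dec; yes; no; ¬_; ¬?; _×-dec_; _⊎-dec_)
open import Relation.Nullary.Decidable using (map′; decidable-stable)
open import Relation.Unary using (Pred; Decidable)
open import Relation.Binary.Core using (_Preserves_⟶_)
open import Relation.Binary.Definitions using (DecidableEquality)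
open import Relation.Binary.PropositionalEquality using (_≡_; refl; sym; trans; cong; cong₂; subst; subst₂; module ≡-Reasoning)
open import Algebra.Properties.CommutativeSemigroup +-commutativeSemigroup using (interchange; xy∙z≈y∙xz)

-- Call a vertex of G(n;m) blocked if no Z-avoiding path from (0,0) reaches it, and let B_s be
-- the number of blocked vertices on L_s.  A blocked vertex of L_{s+1} lies in Z or is stuck:
-- none of its in-neighbours is reachable.  While L_s still contains a reachable vertex c,
-- sending a stuck vertex to its in-neighbour on the far side from c is injective into the
-- blocked vertices of L_s, so B_s ≤ |Z ∩ L(0,s)|.  By (G1) and (G2) this is at most s, and
-- below level 2n − m it is smaller than |L_s|, so such a c always exists.  From level 2n − m
-- on every in-neighbour lies in the grid, a stuck vertex needs two adjacent blocked vertices,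
-- and B_{s+1} ≤ |Z ∩ L_{s+1}| + B_s − 1; against the mirror image of (G2) for L(s,2n) this
-- forces B_{2n} = 0, so (n,n) is reachable.

private variable
  A B C : Set
  P Q R : Pred ℕ 0ℓ

χ : Dec A → ℕ
χ (yes _) = 1
χ (no _)  = 0

χ-no : (a? : Dec A) → ¬ A → χ a? ≡ 0
χ-no (yes a) ¬a = ⊥-elim (¬a a)
χ-no (no _)  _  = refl

χ-mono : (a? : Dec A) (b? : Dec B) → (A → B) → χ a? ≤ χ b?
χ-mono (yes a) (yes _) _   = ≤-refl
χ-mono (yes a) (no ¬b) a→b = ⊥-elim (¬b (a→b a))
χ-mono (no _)  _       _   = z≤n

χ-⊎ : (a? : Dec A) (b? : Dec B) (c? : Dec C) → (A → B ⊎ C) → χ a? ≤ χ b? + χ c?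
χ-⊎ (no _)  _       _       _ = z≤n
χ-⊎ (yes _) (yes _) _       _ = s≤s z≤n
χ-⊎ (yes a) (no ¬b) c?      f with f a
... | inj₁ b = ⊥-elim (¬b b)
... | inj₂ c = χ-mono (yes a) c? λ _ → c

χ-disjoint : (a? : Dec A) (b? : Dec B) (c? : Dec C) →
             (A → C) → (B → C) → (A → ¬ B) → χ a? + χ b? ≤ χ c?
χ-disjoint (yes a) (yes b) _       _   _   a→¬b = ⊥-elim (a→¬b a b)
χ-disjoint (yes a) (no _)  c?      a→c _   _    = χ-mono (yes a) c? a→c
χ-disjoint (no _)  b?      c?      _   b→c _    = χ-mono b? c? b→c

χ-< : (a? : Dec A) (b? : Dec B) → χ a? < χ b? → ¬ A × B
χ-< (no ¬a) (yes b) _ = ¬a , b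
χ-< (yes _) (yes _) (s≤s ())
χ-< (yes _) (no _)  ()
χ-< (no _)  (no _)  ()

count : Decidable P → ℕ → ℕ
count P? zero    = 0
count P? (suc N) = count P? N + χ (P? N)

count-mono : (P? : Decidable P) (Q? : Decidable Q) → ∀ N → (∀ i → i < N → P i → Q i) → count P? N ≤ count Q? N
count-mono P? Q? zero    _   = z≤n
count-mono P? Q? (suc N) P⇒Q =
  +-mono-≤ (count-mono P? Q? N λ i i<N → P⇒Q i (m<n⇒m<1+n i<N)) (χ-mono (P? N) (Q? N) (P⇒Q N ≤-refl))

count-⊎ : (P? : Decidable P) (Q? : Decidable Q) (R? : Decidable R) →
          ∀ N → (∀ i → P i → Q i ⊎ R i) → count P? N ≤ count Q? N + count R? N
count-⊎ P? Q? R? zero    _ = z≤n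
count-⊎ P? Q? R? (suc N) f = begin
  count P? N + χ (P? N)                             ≤⟨ +-mono-≤ (count-⊎ P? Q? R? N f) (χ-⊎ (P? N) (Q? N) (R? N) (f N)) ⟩
  (count Q? N + count R? N) + (χ (Q? N) + χ (R? N)) ≡⟨ interchange (count Q? N) (count R? N) (χ (Q? N)) (χ (R? N)) ⟩
  (count Q? N + χ (Q? N)) + (count R? N + χ (R? N)) ∎
  where open ≤-Reasoning

count-monoʳ : (P? : Decidable P) {M N : ℕ} → M ≤ N → count P? M ≤ count P? N
count-monoʳ P? {M} M≤N = go (≤⇒≤′ M≤N)
  where
  go : ∀ {N} → M ≤′ N → count P? M ≤ count P? N
  go ≤′-refl       = ≤-refl
  go (≤′-step M≤N) = ≤-trans (go M≤N) (m≤m+n _ _)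

module _ (P? : Decidable P) where

  count-interval : ∀ a k → (∀ i → i < k → P (a + i)) → k ≤ count P? (a + k)
  count-interval a zero    _  = z≤n
  count-interval a (suc k) Pa rewrite +-suc a k = begin
    suc k                             ≡⟨ +-comm 1 k ⟩
    k + 1                             ≤⟨ +-mono-≤ (count-interval a k λ i i<k → Pa i (m<n⇒m<1+n i<k))
                                                  (χ-mono (yes (Pa k ≤-refl)) (P? (a + k)) id) ⟩
    count P? (a + k) + χ (P? (a + k)) ∎
    where open ≤-Reasoning

  count≡0⇒none : ∀ {N i} → count P? N ≡ 0 → i < N → ¬ P i
  count≡0⇒none {N} {i} count≡0 i<N Pi = <-irrefl refl (begin-strict
    0                   <⟨ count-interval i 1 (λ { zero _ → subst P (sym (+-identityʳ i)) Pi ; (suc _) (s≤s ()) }) ⟩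
    count P? (i + 1)    ≤⟨ count-monoʳ P? (≤-trans (≤-reflexive (+-comm i 1)) i<N) ⟩
    count P? N          ≡⟨ count≡0 ⟩
    0                   ∎)
    where open ≤-Reasoning

  count-∘suc : ∀ N → count P? (suc N) ≡ χ (P? 0) + count (P? ∘ suc) N
  count-∘suc zero    = +-comm 0 _
  count-∘suc (suc N) = trans (cong (_+ χ (P? (suc N))) (count-∘suc N)) (+-assoc (χ (P? 0)) _ _)

  none⇒count≡0 : ∀ N → (∀ i → i < N → ¬ P i) → count P? N ≡ 0
  none⇒count≡0 zero    _  = refl
  none⇒count≡0 (suc N) ¬P = trans (cong (_+_ (count P? N)) (χ-no (P? N) (¬P N ≤-refl)))
                                (trans (+-identityʳ _) (none⇒count≡0 N λ i i<N → ¬P i (m<n⇒m<1+n i<N)))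

  count-≤1 : ∀ N → (∀ {i j} → P i → P j → i ≡ j) → count P? N ≤ 1
  count-≤1 zero    _      = z≤n
  count-≤1 (suc N) unique with P? N
  ... | no _  = ≤-trans (≤-reflexive (+-identityʳ _)) (count-≤1 N unique)
  ... | yes p = ≤-reflexive (cong (_+ 1) (none⇒count≡0 N λ i i<N Pi → <-irrefl (unique Pi p) i<N))

  count-adjacent : ∀ N → count (λ i → P? i ×-dec P? (suc i)) N ≤ count P? (suc N) ∸ 1
  count-adjacent zero = z≤n
  count-adjacent (suc N) with P? N | P? (suc N) | count-adjacent N
  ... | yes _ | no _  | ih =
    ≤-trans (≤-reflexive (+-identityʳ _)) (≤-trans ih (∸-monoˡ-≤ 1 (m≤m+n (count P? N + 1) 0)))
  ... | no _  | no _  | ih =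
    ≤-trans (≤-reflexive (+-identityʳ _)) (≤-trans ih (∸-monoˡ-≤ 1 (m≤m+n (count P? N + 0) 0)))
  ... | no _  | yes _ | ih =
    ≤-trans (≤-reflexive (+-identityʳ _)) (≤-trans ih (≤-trans (m∸n≤m (count P? N + 0) 1) (≤-reflexive (sym (m+n∸n≡m _ 1)))))
  ... | yes _ | yes _ | ih = begin
    count (λ i → P? i ×-dec P? (suc i)) N + 1 ≤⟨ +-monoˡ-≤ 1 ih ⟩
    (count P? N + 1) ∸ 1 + 1                  ≡⟨ cong (_+ 1) (m+n∸n≡m (count P? N) 1) ⟩
    count P? N + 1                            ≡⟨ sym (m+n∸n≡m _ 1) ⟩
    (count P? N + 1 + 1) ∸ 1                  ∎
    where open ≤-Reasoning

module _ (P? : Decidable P) (Q? : Decidable Q) where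

  count-< : ∀ N → count P? N < count Q? N → ∃[ i ] i < N × ¬ P i × Q i
  count-< (suc N) lt with count P? N <? count Q? N
  ... | yes lt′ = let i , i<N , wit = count-< N lt′ in i , m<n⇒m<1+n i<N , wit
  ... | no ≮    = N , ≤-refl ,
    χ-< (P? N) (Q? N) (+-cancelˡ-< (count P? N) _ _ (<-≤-trans lt (+-monoˡ-≤ _ (≮⇒≥ ≮))))

  -- P injects into Q by i ↦ i for i ≤ c and i ↦ i − 1 for i > c; the two ranges cannot
  -- collide because c itself is not in Q.
  module _ {c} (gap : ¬ Q c) (below : ∀ i → i ≤ c → P i → Q i)
           (above : ∀ i → c ≤ i → P (suc i) → Q i) where

    count-shifted : ∀ {N} → c ≤′ N → count P? (suc N) ≤ count Q? N
    count-shifted ≤′-refl = begin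
      count P? c + χ (P? c) ≤⟨ +-mono-≤ (count-mono P? Q? c λ i i<c → below i (<⇒≤ i<c))
                                        (χ-mono (P? c) (no gap) (below c ≤-refl)) ⟩
      count Q? c + 0        ≡⟨ +-identityʳ _ ⟩
      count Q? c            ∎
      where open ≤-Reasoning
    count-shifted (≤′-step {N} c≤N) =
      +-mono-≤ (count-shifted c≤N) (χ-mono (P? (suc N)) (Q? N) (above N (≤′⇒≤ c≤N)))

    count-≤-across-gap : ∀ N → count P? N ≤ count Q? N
    count-≤-across-gap N with N ≤? c
    count-≤-across-gap N       | yes N≤c = count-mono P? Q? N λ i i<N → below i (<⇒≤ (<-≤-trans i<N N≤c))
    count-≤-across-gap zero    | no  0≰c = ⊥-elim (0≰c z≤n)
    count-≤-across-gap (suc N) | no  N≰c =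
      ≤-trans (count-shifted (≤⇒≤′ (s≤s⁻¹ (≰⇒> N≰c)))) (count-monoʳ Q? (n≤1+n N))

  count-≤-pairs : ¬ P 0 → (∀ i → P (suc i) → Q i × Q (suc i)) →
                  ∀ N → count P? (suc N) ≤ count Q? (suc N) ∸ 1
  count-≤-pairs ¬P0 P⇒pair N = begin
    count P? (suc N)                           ≡⟨ count-∘suc P? N ⟩
    χ (P? 0) + count (P? ∘ suc) N              ≡⟨ cong (_+ count (P? ∘ suc) N) (χ-no (P? 0) ¬P0) ⟩
    count (P? ∘ suc) N                         ≤⟨ count-mono (P? ∘ suc) (λ i → Q? i ×-dec Q? (suc i)) N
                                                             (λ i _ → P⇒pair i) ⟩
    count (λ i → Q? i ×-dec Q? (suc i)) N      ≤⟨ count-adjacent Q? N ⟩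
    count Q? (suc N) ∸ 1                       ∎
    where open ≤-Reasoning

m+m≤n+n⇒m≤n : ∀ {m n} → m + m ≤ n + n → m ≤ n
m+m≤n+n⇒m≤n {m} {n} le = subst₂ _≤_ (sym (n≡⌊n+n/2⌋ m)) (sym (n≡⌊n+n/2⌋ n)) (⌊n/2⌋-mono le)

⌈n/2⌉+⌈n/2⌉≤1+n : ∀ n → ⌈ n /2⌉ + ⌈ n /2⌉ ≤ suc n
⌈n/2⌉+⌈n/2⌉≤1+n zero          = z≤n
⌈n/2⌉+⌈n/2⌉≤1+n (suc zero)    = ≤-refl
⌈n/2⌉+⌈n/2⌉≤1+n (suc (suc n)) rewrite +-suc ⌈ n /2⌉ ⌈ n /2⌉ = s≤s (s≤s (⌈n/2⌉+⌈n/2⌉≤1+n n))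

n≤⌈n/2⌉+⌈n/2⌉ : ∀ n → n ≤ ⌈ n /2⌉ + ⌈ n /2⌉
n≤⌈n/2⌉+⌈n/2⌉ n = ≤-trans (≤-reflexive (sym (⌊n/2⌋+⌈n/2⌉≡n n))) (+-monoˡ-≤ ⌈ n /2⌉ (⌊n/2⌋≤⌈n/2⌉ n))

-- A vertex of L_s is indexed by its first coordinate i, i.e. it is (i , s ∸ i).  With j = s − i
-- the five conditions of InLevel are j ≥ 0, i ≤ n, j ≤ n, i − j ≤ m and j − i ≤ m, with the
-- subtractions cleared.
module Levels (n m : ℕ) where

  InLevel : ℕ → ℕ → Set
  InLevel s i = i ≤ s × i ≤ n × s ≤ n + i × i + i ≤ s + m × s ≤ m + (i + i)

  inLevel? : ∀ s → Decidable (InLevel s)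
  inLevel? s i = i ≤? s ×-dec i ≤? n ×-dec s ≤? n + i ×-dec i + i ≤? s + m ×-dec s ≤? m + (i + i)

  InLevel⇒InGrid : ∀ {s i} → InLevel s i → InGrid n m (i , s ∸ i)
  InLevel⇒InGrid {s} {i} (i≤s , i≤n , s≤n+i , i+i≤s+m , s≤m+i+i) =
    i≤n , m≤n+o⇒m∸n≤o s i (subst (s ≤_) (+-comm n i) s≤n+i) , i∸j≤m , j∸i≤m
    where
    j = s ∸ i
    j+i≡s : j + i ≡ s
    j+i≡s = m∸n+n≡m i≤s
    i∸j≤m : i ∸ j ≤ m
    i∸j≤m = m≤n+o⇒m∸n≤o i j (+-cancelˡ-≤ i i (j + m) (begin
      i + i         ≤⟨ i+i≤s+m ⟩
      s + m         ≡⟨ cong (_+ m) (trans (sym j+i≡s) (+-comm j i)) ⟩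
      i + j + m     ≡⟨ +-assoc i j m ⟩
      i + (j + m)   ∎))
      where open ≤-Reasoning
    j∸i≤m : j ∸ i ≤ m
    j∸i≤m = m≤n+o⇒m∸n≤o j i (subst (j ≤_) (+-comm m i) (+-cancelʳ-≤ i j (m + i)
              (subst₂ _≤_ (sym j+i≡s) (sym (+-assoc m i i)) s≤m+i+i)))

  InLevel-below : ∀ {s i c} → InLevel (suc s) i → InLevel s c → i ≤ c → InLevel s i
  InLevel-below {s} (_ , i≤n , s<n+i , _ , s<m+i+i) (c≤s , _ , _ , c+c≤s+m , _) i≤c =
    ≤-trans i≤c c≤s , i≤n , <⇒≤ s<n+i , ≤-trans (+-mono-≤ i≤c i≤c) c+c≤s+m , <⇒≤ s<m+i+i

  InLevel-left : ∀ {s i c} → InLevel (suc s) (suc i) → InLevel s c → c ≤ i → InLevel s i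
  InLevel-left {s} {i} (i<s+1 , i<n , s<n+i+1 , i+i+2≤s+m+1 , _) (_ , _ , _ , _ , s≤m+c+c) c≤i =
    s≤s⁻¹ i<s+1 , <⇒≤ i<n , s≤s⁻¹ (subst (suc s ≤_) (+-suc n i) s<n+i+1) ,
    ≤-trans (+-monoʳ-≤ i (n≤1+n i)) (s≤s⁻¹ i+i+2≤s+m+1) , ≤-trans s≤m+c+c (+-monoʳ-≤ m (+-mono-≤ c≤i c≤i))

  module _ (m≤n : m ≤ n) {s} (top : n + n ≤ s + m) where

    private
      n≤s : n ≤ s
      n≤s = +-cancelʳ-≤ n n s (≤-trans top (+-monoʳ-≤ s m≤n))

    ¬InLevel-top-0 : ¬ InLevel (suc s) 0
    ¬InLevel-top-0 (_ , _ , s<n+0 , _ , _) = <⇒≱ (subst (suc s ≤_) (+-identityʳ n) s<n+0) n≤s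

    InLevel-top : ∀ {i} → InLevel (suc s) (suc i) → InLevel s i × InLevel s (suc i)
    InLevel-top {i} (_ , i<n , s<n+i+1 , _ , s<m+i+i) =
      (≤-trans (<⇒≤ i<n) n≤s , <⇒≤ i<n , s≤n+i , ≤-trans (+-mono-≤ (<⇒≤ i<n) (<⇒≤ i<n)) top , s≤m+i+i) ,
      (≤-trans i<n n≤s , i<n , ≤-trans (n≤1+n s) s<n+i+1 , ≤-trans (+-mono-≤ i<n i<n) top , ≤-trans (n≤1+n s) s<m+i+i)
      where
      s≤n+i : s ≤ n + i
      s≤n+i = s≤s⁻¹ (subst (suc s ≤_) (+-suc n i) s<n+i+1)
      s≤m+i+i : s ≤ m + (i + i)
      s≤m+i+i = +-cancelˡ-≤ s s (m + (i + i)) (begin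
        s + s                 ≤⟨ +-mono-≤ s≤n+i s≤n+i ⟩
        (n + i) + (n + i)     ≡⟨ interchange n i n i ⟩
        (n + n) + (i + i)     ≤⟨ +-monoˡ-≤ (i + i) top ⟩
        (s + m) + (i + i)     ≡⟨ +-assoc s m (i + i) ⟩
        s + (m + (i + i))     ∎)
        where open ≤-Reasoning

  InLevel-low : ∀ {s i} → m ≤ n → s ≤ m → i ≤ s → InLevel s i
  InLevel-low {s} {i} m≤n s≤m i≤s =
    i≤s , ≤-trans i≤s s≤n , ≤-trans s≤n (m≤m+n n i) , +-mono-≤ i≤s (≤-trans i≤s s≤m) , ≤-trans s≤m (m≤m+n m _)
    where s≤n = ≤-trans s≤m m≤n

  InLevel-middle : ∀ {d k} → 1 ≤ m → (m + d) + m ≤ n + n → k + k ≤ m → InLevel (m + d) (⌈ d /2⌉ + k)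
  InLevel-middle {d} {k} 1≤m s+m≤n+n k+k≤m =
    i≤s , i≤n , s≤n+i , i+i≤s+m , +-monoʳ-≤ m (≤-trans d≤h+h h+h≤i+i)
    where
    h = ⌈ d /2⌉
    i = h + k
    s = m + d
    d≤h+h : d ≤ h + h
    d≤h+h = n≤⌈n/2⌉+⌈n/2⌉ d
    h+h≤i+i : h + h ≤ i + i
    h+h≤i+i = +-mono-≤ (m≤m+n h k) (m≤m+n h k)
    i≤s : i ≤ s
    i≤s = ≤-trans (+-mono-≤ (⌈n/2⌉≤n d) (≤-trans (m≤m+n k k) k+k≤m)) (≤-reflexive (+-comm d m))
    i+i≤s+m : i + i ≤ s + m
    i+i≤s+m = begin
      i + i             ≡⟨ interchange h k h k ⟩
      (h + h) + (k + k) ≤⟨ +-mono-≤ (⌈n/2⌉+⌈n/2⌉≤1+n d) k+k≤m ⟩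
      suc d + m         ≡⟨ cong suc (+-comm d m) ⟩
      suc s             ≡⟨ +-comm 1 s ⟩
      s + 1             ≤⟨ +-monoʳ-≤ s 1≤m ⟩
      s + m             ∎
      where open ≤-Reasoning
    i≤n : i ≤ n
    i≤n = m+m≤n+n⇒m≤n (≤-trans i+i≤s+m s+m≤n+n)
    s≤n+i : s ≤ n + i
    s≤n+i = ≤-trans (m+m≤n+n⇒m≤n (begin
      s + s             ≡⟨ sym (+-assoc s m d) ⟩
      (s + m) + d       ≤⟨ +-mono-≤ s+m≤n+n d≤h+h ⟩
      (n + n) + (h + h) ≡⟨ interchange n n h h ⟩
      (n + h) + (n + h) ∎)) (+-monoʳ-≤ n (m≤m+n h k))
      where open ≤-Reasoning

module _ {A : Set} {P Q : Pred A 0ℓ} (P? : Decidable P) (Q? : Decidable Q) where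

  private
    length-filter-∷ : ∀ {R : Pred A 0ℓ} (R? : Decidable R) x xs →
                      length (filter R? (x ∷ xs)) ≡ χ (R? x) + length (filter R? xs)
    length-filter-∷ R? x xs with R? x
    ... | yes _ = refl
    ... | no _  = refl

  length-filter-mono : (∀ x → P x → Q x) → ∀ xs → length (filter P? xs) ≤ length (filter Q? xs)
  length-filter-mono P⇒Q []       = z≤n
  length-filter-mono P⇒Q (x ∷ xs) = subst₂ _≤_ (sym (length-filter-∷ P? x xs)) (sym (length-filter-∷ Q? x xs))
    (+-mono-≤ (χ-mono (P? x) (Q? x) (P⇒Q x)) (length-filter-mono P⇒Q xs))

  length-filter-disjoint : ∀ {R} (R? : Decidable R) →
    (∀ x → P x → R x) → (∀ x → Q x → R x) → (∀ x → P x → ¬ Q x) →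
    ∀ xs → length (filter P? xs) + length (filter Q? xs) ≤ length (filter R? xs)
  length-filter-disjoint R? P⇒R Q⇒R P⇒¬Q []       = z≤n
  length-filter-disjoint R? P⇒R Q⇒R P⇒¬Q (x ∷ xs) = begin
    length (filter P? (x ∷ xs)) + length (filter Q? (x ∷ xs))
      ≡⟨ cong₂ _+_ (length-filter-∷ P? x xs) (length-filter-∷ Q? x xs) ⟩
    (χ (P? x) + length (filter P? xs)) + (χ (Q? x) + length (filter Q? xs))
      ≡⟨ interchange (χ (P? x)) _ _ _ ⟩
    (χ (P? x) + χ (Q? x)) + (length (filter P? xs) + length (filter Q? xs))
      ≤⟨ +-mono-≤ (χ-disjoint (P? x) (Q? x) (R? x) (P⇒R x) (Q⇒R x) (P⇒¬Q x))
                  (length-filter-disjoint R? P⇒R Q⇒R P⇒¬Q xs) ⟩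
    χ (R? x) + length (filter R? xs)
      ≡⟨ sym (length-filter-∷ R? x xs) ⟩
    length (filter R? (x ∷ xs)) ∎
    where open ≤-Reasoning

module _ {A : Set} (_≟_ : DecidableEquality A) where
  open import Data.List.Membership.DecPropositional _≟_ using (_∈?_)

  count-∈-≤-length : ∀ {g : ℕ → A} → (∀ {i j} → g i ≡ g j → i ≡ j) →
                     ∀ xs N → count (λ i → g i ∈? xs) N ≤ length xs
  count-∈-≤-length {g} g-inj []       N = ≤-reflexive (none⇒count≡0 (λ i → g i ∈? []) N λ _ _ ())
  count-∈-≤-length {g} g-inj (x ∷ xs) N = begin
    count (λ i → g i ∈? x ∷ xs) N                     ≤⟨ count-⊎ _ _ (λ i → g i ∈? xs) N here-or-there ⟩
    count (λ i → g i ≟ x) N + count (λ i → g i ∈? xs) N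
                                                      ≤⟨ +-mono-≤ (count-≤1 (λ i → g i ≟ x) N λ p q → g-inj (trans p (sym q)))
                                                                  (count-∈-≤-length g-inj xs N) ⟩
    suc (length xs)                                   ∎
    where
    open ≤-Reasoning
    here-or-there : ∀ i → g i ∈ x ∷ xs → g i ≡ x ⊎ g i ∈ xs
    here-or-there i (here p)  = inj₁ p
    here-or-there i (there p) = inj₂ p

levelSize : ℕ → List Vertex → ℕ
levelSize s L = length (filter (λ v → level v ≟ s) L)

module _ (L : List Vertex) where

  countLow-mono : ∀ {a b} → a ≤ b → countLow a L ≤ countLow b L
  countLow-mono a≤b = length-filter-mono (λ v → level v ≤? _) (λ v → level v ≤? _) (λ _ l≤a → ≤-trans l≤a a≤b) L

  countHigh-antimono : ∀ {a b} → a ≤ b → countHigh b L ≤ countHigh a L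
  countHigh-antimono a≤b = length-filter-mono (λ v → _ ≤? level v) (λ v → _ ≤? level v) (λ _ → ≤-trans a≤b) L

  levelSize-0 : levelSize 0 L ≤ countLow 0 L
  levelSize-0 = length-filter-mono (λ v → level v ≟ 0) (λ v → level v ≤? 0) (λ _ → ≤-reflexive) L

  levelSize+countLow : ∀ t → levelSize (suc t) L + countLow t L ≤ countLow (suc t) L
  levelSize+countLow t = length-filter-disjoint (λ v → level v ≟ suc t) (λ v → level v ≤? t) (λ v → level v ≤? suc t)
    (λ _ → ≤-reflexive) (λ _ → m≤n⇒m≤1+n) (λ _ l≡t+1 l≤t → <⇒≱ (≤-reflexive (sym l≡t+1)) l≤t) L

  levelSize+countHigh : ∀ t → levelSize t L + countHigh (suc t) L ≤ countHigh t L
  levelSize+countHigh t = length-filter-disjoint (λ v → level v ≟ t) (λ v → suc t ≤? level v) (λ v → t ≤? level v)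
    (λ _ l≡t → ≤-reflexive (sym l≡t)) (λ _ → <⇒≤) (λ _ l≡t t<l → <-irrefl (sym l≡t) t<l) L

  countLow+countHigh : ∀ t → countLow t L + countHigh (suc t) L ≤ length L
  countLow+countHigh t = ≤-trans
    (length-filter-disjoint (λ v → level v ≤? t) (λ v → suc t ≤? level v) (λ _ → yes tt)
      (λ _ _ → tt) (λ _ _ → tt) (λ _ → ≤⇒≯) L)
    (length-filter (λ _ → yes tt) L)

_≟ᵥ_ : DecidableEquality Vertex
_≟ᵥ_ = ≡-dec _≟_ _≟_

module Reachability (n m : ℕ) (Z : List Vertex) where
  open Levels n m
  open import Data.List.Membership.DecPropositional _≟ᵥ_ using (_∈?_)

  Free : ℕ → ℕ → Set
  Free s i = InLevel s i × (i , s ∸ i) ∉ Z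

  free? : ∀ s → Decidable (Free s)
  free? s i = inLevel? s i ×-dec ¬? ((i , s ∸ i) ∈? Z)

  data Reach : ℕ → ℕ → Set where
    origin : Free 0 0 → Reach 0 0
    up     : ∀ {s i} → Free (suc s) i → Reach s i → Reach (suc s) i
    right  : ∀ {s i} → Free (suc s) (suc i) → Reach s i → Reach (suc s) (suc i)

  reach? : ∀ s → Decidable (Reach s)
  reach? zero    zero    = map′ origin (λ { (origin f) → f }) (free? 0 0)
  reach? zero    (suc i) = no λ ()
  reach? (suc s) zero    = map′ (uncurry up) (λ { (up f r) → f , r }) (free? (suc s) 0 ×-dec reach? s 0)
  reach? (suc s) (suc i) = map′ (λ { (f , inj₁ r) → up f r ; (f , inj₂ r) → right f r })
                                (λ { (up f r) → f , inj₁ r ; (right f r) → f , inj₂ r })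
                                (free? (suc s) (suc i) ×-dec (reach? s (suc i) ⊎-dec reach? s i))

  Reach⇒InLevel : ∀ {s i} → Reach s i → InLevel s i
  Reach⇒InLevel (origin (g , _))  = g
  Reach⇒InLevel (up (g , _) _)    = g
  Reach⇒InLevel (right (g , _) _) = g

  PathFromOrigin : Vertex → Set
  PathFromOrigin v = Σ (List Vertex) λ p → IsPathFromTo n m (0 , 0) v p × All (_∉ Z) p

  IsPathFromTo-snoc : ∀ {u v w p} → IsPathFromTo n m u v p → Arc v w → InGrid n m w →
                      IsPathFromTo n m u w (p ++ w ∷ [])
  IsPathFromTo-snoc (single g)      a gw = step g a (single gw)
  IsPathFromTo-snoc (step g a path) b gw = step g a (IsPathFromTo-snoc path b gw)

  PathFromOrigin-extend : ∀ {v w} → PathFromOrigin v → Arc v w → InGrid n m w → w ∉ Z → PathFromOrigin w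
  PathFromOrigin-extend {w = w} (p , path , avoid) a gw w∉Z =
    p ++ w ∷ [] , IsPathFromTo-snoc path a gw , All.++⁺ avoid (w∉Z ∷ [])

  Reach⇒PathFromOrigin : ∀ {s i} → Reach s i → PathFromOrigin (i , s ∸ i)
  Reach⇒PathFromOrigin (origin (g , z∉Z)) = (0 , 0) ∷ [] , single (InLevel⇒InGrid g) , z∉Z ∷ []
  Reach⇒PathFromOrigin (up (g , v∉Z) r) =
    PathFromOrigin-extend (Reach⇒PathFromOrigin r) (inj₁ (refl , +-∸-assoc 1 (proj₁ (Reach⇒InLevel r))))
                          (InLevel⇒InGrid g) v∉Z
  Reach⇒PathFromOrigin (right (g , v∉Z) r) =
    PathFromOrigin-extend (Reach⇒PathFromOrigin r) (inj₂ (refl , refl)) (InLevel⇒InGrid g) v∉Z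

  Blocked : ℕ → ℕ → Set
  Blocked s i = InLevel s i × ¬ Reach s i

  blocked? : ∀ s → Decidable (Blocked s)
  blocked? s i = inLevel? s i ×-dec ¬? (reach? s i)

  InZ : ℕ → ℕ → Set
  InZ s i = InLevel s i × (i , s ∸ i) ∈ Z

  inZ? : ∀ s → Decidable (InZ s)
  inZ? s i = inLevel? s i ×-dec (i , s ∸ i) ∈? Z

  -- The in-neighbours of (i , s + 1 − i) are (i , s − i) and (i − 1 , s + 1 − i), both on L_s.
  Stuck : ℕ → ℕ → Set
  Stuck s zero    = InLevel (suc s) 0 × ¬ Reach s 0
  Stuck s (suc i) = InLevel (suc s) (suc i) × ¬ Reach s (suc i) × ¬ Reach s i

  stuck? : ∀ s → Decidable (Stuck s)
  stuck? s zero    = inLevel? (suc s) 0 ×-dec ¬? (reach? s 0)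
  stuck? s (suc i) = inLevel? (suc s) (suc i) ×-dec ¬? (reach? s (suc i)) ×-dec ¬? (reach? s i)

  Stuck⇒¬Reach : ∀ {s} i → Stuck s i → ¬ Reach s i
  Stuck⇒¬Reach zero    (_ , ¬r)     = ¬r
  Stuck⇒¬Reach (suc i) (_ , ¬r , _) = ¬r

  Blocked-0 : ∀ {i} → Blocked 0 i → InZ 0 i
  Blocked-0 {i} (g , ¬r) with (i , 0 ∸ i) ∈? Z
  ... | yes v∈Z = g , v∈Z
  Blocked-0 {.0} (g@(z≤n , _) , ¬r) | no v∉Z = ⊥-elim (¬r (origin (g , v∉Z)))

  Blocked-suc : ∀ {s} i → Blocked (suc s) i → InZ (suc s) i ⊎ Stuck s i
  Blocked-suc {s} i (g , ¬r) with (i , suc s ∸ i) ∈? Z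
  Blocked-suc     i       (g , ¬r) | yes v∈Z = inj₁ (g , v∈Z)
  Blocked-suc     zero    (g , ¬r) | no  v∉Z = inj₂ (g , ¬r ∘ up (g , v∉Z))
  Blocked-suc     (suc i) (g , ¬r) | no  v∉Z = inj₂ (g , ¬r ∘ up (g , v∉Z) , ¬r ∘ right (g , v∉Z))

  blockedCount stuckCount zCount width : ℕ → ℕ
  blockedCount s = count (blocked? s) (suc n)
  stuckCount   s = count (stuck? s) (suc n)
  zCount       s = count (inZ? s) (suc n)
  width        s = count (inLevel? s) (suc n)

  blockedCount-0 : blockedCount 0 ≤ zCount 0
  blockedCount-0 = count-mono (blocked? 0) (inZ? 0) (suc n) λ _ _ → Blocked-0

  blockedCount-suc : ∀ s → blockedCount (suc s) ≤ zCount (suc s) + stuckCount s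
  blockedCount-suc s = count-⊎ (blocked? (suc s)) (inZ? (suc s)) (stuck? s) (suc n) Blocked-suc

  stuckCount≤blockedCount : ∀ {s c} → Reach s c → stuckCount s ≤ blockedCount s
  stuckCount≤blockedCount {s} {c} r = count-≤-across-gap (stuck? s) (blocked? s) (λ (_ , ¬r) → ¬r r) below above (suc n)
    where
    c∈L = Reach⇒InLevel r
    below : ∀ i → i ≤ c → Stuck s i → Blocked s i
    below zero    i≤c st@(g , _) = InLevel-below g c∈L i≤c , Stuck⇒¬Reach zero st
    below (suc i) i≤c st@(g , _) = InLevel-below g c∈L i≤c , Stuck⇒¬Reach (suc i) st
    above : ∀ i → c ≤ i → Stuck s (suc i) → Blocked s i
    above i c≤i (g , _ , ¬r) = InLevel-left g c∈L c≤i , ¬r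

  -- Above level 2n − m both in-neighbours of every vertex lie in the grid.
  stuckCount-top : ∀ {s} → m ≤ n → n + n ≤ s + m → stuckCount s ≤ blockedCount s ∸ 1
  stuckCount-top {s} m≤n top = count-≤-pairs (stuck? s) (blocked? s) (¬InLevel-top-0 m≤n top ∘ proj₁) pair n
    where
    pair : ∀ i → Stuck s (suc i) → Blocked s i × Blocked s (suc i)
    pair i (g , ¬r′ , ¬r) = let g , g′ = InLevel-top m≤n top g in (g , ¬r) , (g′ , ¬r′)

  reachable-on-level : ∀ {s} → blockedCount s < width s → ∃[ c ] Reach s c
  reachable-on-level {s} lt =
    let c , _ , ¬blocked , g = count-< (blocked? s) (inLevel? s) (suc n) lt
    in c , decidable-stable (reach? s c) (λ ¬r → ¬blocked (g , ¬r))

  zCount≤levelSize : ∀ s → zCount s ≤ levelSize s Z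
  zCount≤levelSize s = ≤-trans
    (count-mono (inZ? s) (λ i → (i , s ∸ i) ∈? Zₛ) (suc n)
      λ i _ (g , v∈Z) → ∈-filter⁺ (λ v → level v ≟ s) v∈Z (m+[n∸m]≡n (proj₁ g)))
    (count-∈-≤-length _≟ᵥ_ (cong proj₁) Zₛ (suc n))
    where Zₛ = filter (λ v → level v ≟ s) Z

∸1-step : ∀ {b h s D} → b + h + s ≤ D → h + suc s ≤ D → (b ∸ 1) + h + suc s ≤ D
∸1-step {zero}          _        h+s+1≤D = h+s+1≤D
∸1-step {suc b} {h} {s} {D} b+h+s≤D _    = subst (_≤ D) (sym (+-suc (b + h) s)) b+h+s≤D

-- If y + ℓ ≤ m the next multiple of ℓ above y bounds g y by ⌊y/ℓ⌋; otherwise y > m/2 ≥ M.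
staircase⇒≤id : ∀ {g : ℕ → ℕ} {ℓ m M} .{{_ : NonZero ℓ}} → g Preserves _≤_ ⟶ _≤_ →
  (∀ i → 1 ≤ i → i * ℓ ≤ m → g (i * ℓ) ≤ i ∸ 1) → (∀ y → g y ≤ M) → M + M ≤ m → ℓ + ℓ ≤ m →
  ∀ y → g y ≤ y
staircase⇒≤id {g} {ℓ} {m} {M} g-mono steps g≤M M+M≤m ℓ+ℓ≤m y with y + ℓ ≤? m
... | yes y+ℓ≤m = begin
  g y             ≤⟨ g-mono (<⇒≤ y<iℓ) ⟩
  g (suc q * ℓ)   ≤⟨ steps (suc q) (s≤s z≤n) iℓ≤m ⟩
  q               ≤⟨ m/n≤m y ℓ ⟩
  y               ∎
  where
  open ≤-Reasoning
  q = y div ℓ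
  y<iℓ : y < suc q * ℓ
  y<iℓ = subst (_< suc q * ℓ) (sym (m≡m%n+[m/n]*n y ℓ)) (+-monoˡ-< (q * ℓ) (m%n<n y ℓ))
  iℓ≤m : suc q * ℓ ≤ m
  iℓ≤m = ≤-trans (+-monoʳ-≤ ℓ (m/n*n≤m y ℓ)) (≤-trans (≤-reflexive (+-comm ℓ y)) y+ℓ≤m)
... | no  y+ℓ≰m = ≤-trans (g≤M y) (m+m≤n+n⇒m≤n (<⇒≤ (≤-<-trans M+M≤m m<y+y)))
  where
  m<y+y : m < y + y
  m<y+y = +-cancelʳ-< m m (y + y) (begin-strict
    m + m             <⟨ +-mono-< (≰⇒> y+ℓ≰m) (≰⇒> y+ℓ≰m) ⟩
    (y + ℓ) + (y + ℓ) ≡⟨ interchange y ℓ y ℓ ⟩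
    (y + y) + (ℓ + ℓ) ≤⟨ +-monoʳ-≤ (y + y) ℓ+ℓ≤m ⟩
    (y + y) + m       ∎)
    where open ≤-Reasoning

module CornerToCorner {n m ℓ : ℕ} .{{_ : NonZero ℓ}} {Z : List Vertex}
  (m≤n : m ≤ n) (ℓ+ℓ≤m : ℓ + ℓ ≤ m) (G1 : 10 * length Z ≤ m)
  (G2 : (i : ℕ) → 1 ≤ i → i * ℓ ≤ m →
        (countLow (i * ℓ) Z ≤ i ∸ 1) × (countHigh (2 * n ∸ i * ℓ) Z ≤ i ∸ 1)) where
  open Levels n m
  open Reachability n m Z

  |Z|+|Z|≤m : length Z + length Z ≤ m
  |Z|+|Z|≤m = ≤-trans (+-monoʳ-≤ (length Z) (m≤m+n (length Z) _)) G1

  |Z|≤m : length Z ≤ m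
  |Z|≤m = ≤-trans (m≤m+n _ _) |Z|+|Z|≤m

  1≤m : 1 ≤ m
  1≤m = ≤-trans (m≤m+n 1 _) (≤-trans (+-mono-≤ (>-nonZero⁻¹ ℓ) (>-nonZero⁻¹ ℓ)) ℓ+ℓ≤m)

  countLow≤ : ∀ s → countLow s Z ≤ s
  countLow≤ = staircase⇒≤id (countLow-mono Z) (λ i 1≤i iℓ≤m → proj₁ (G2 i 1≤i iℓ≤m))
                            (λ s → length-filter _ Z) |Z|+|Z|≤m ℓ+ℓ≤m

  countHigh≤ : ∀ s → s ≤ n + n → countHigh s Z + s ≤ n + n
  countHigh≤ s s≤2n = begin
    countHigh s Z + s                   ≡⟨ cong (λ t → countHigh t Z + s) (sym (m∸[m∸n]≡n s≤2n)) ⟩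
    countHigh (n + n ∸ (n + n ∸ s)) Z + s ≤⟨ +-monoˡ-≤ s (bound (n + n ∸ s)) ⟩
    (n + n ∸ s) + s                     ≡⟨ m∸n+n≡m s≤2n ⟩
    n + n                               ∎
    where
    open ≤-Reasoning
    2n≡n+n : 2 * n ≡ n + n
    2n≡n+n = cong (_+_ n) (+-identityʳ n)
    bound : ∀ y → countHigh (n + n ∸ y) Z ≤ y
    bound = staircase⇒≤id (countHigh-antimono Z ∘ ∸-monoʳ-≤ (n + n))
              (λ i 1≤i iℓ≤m → subst (λ t → countHigh (t ∸ i * ℓ) Z ≤ i ∸ 1) 2n≡n+n (proj₂ (G2 i 1≤i iℓ≤m)))
              (λ y → length-filter _ Z) |Z|+|Z|≤m ℓ+ℓ≤m

  |Z|<width-middle : ∀ d → (m + d) + m ≤ n + n → length Z < width (m + d)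
  |Z|<width-middle d s+m≤2n = begin
    suc (length Z)                                ≤⟨ count-interval (inLevel? (m + d)) h (suc (length Z)) in-level ⟩
    count (inLevel? (m + d)) (h + suc (length Z)) ≤⟨ count-monoʳ (inLevel? (m + d)) h+|Z|<1+n ⟩
    width (m + d)                                 ∎
    where
    open ≤-Reasoning
    h = ⌈ d /2⌉
    in-level : ∀ k → k < suc (length Z) → InLevel (m + d) (h + k)
    in-level k k<1+|Z| = InLevel-middle 1≤m s+m≤2n (≤-trans (+-mono-≤ k≤|Z| k≤|Z|) |Z|+|Z|≤m)
      where k≤|Z| = s≤s⁻¹ k<1+|Z|
    h+|Z|<1+n : h + suc (length Z) ≤ suc n
    h+|Z|<1+n = subst (_≤ suc n) (sym (+-suc h (length Z))) (s≤s (proj₁ (proj₂ (in-level (length Z) ≤-refl))))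

  countLow<width : ∀ s → s + m ≤ n + n → countLow s Z < width s
  countLow<width s s+m≤2n with s ≤? m
  ... | yes s≤m = begin-strict
    countLow s Z                   ≤⟨ countLow≤ s ⟩
    s                              <⟨ ≤-refl ⟩
    suc s                          ≤⟨ count-interval (inLevel? s) 0 (suc s) low ⟩
    count (inLevel? s) (suc s)     ≤⟨ count-monoʳ (inLevel? s) (s≤s (≤-trans s≤m m≤n)) ⟩
    width s                        ∎
    where
    open ≤-Reasoning
    low : ∀ i → i < suc s → InLevel s i
    low i i<s+1 = InLevel-low m≤n s≤m (s≤s⁻¹ i<s+1)
  ... | no  s≰m = subst (λ s → countLow s Z < width s) (m+[n∸m]≡n m≤s)
                        (≤-<-trans (length-filter _ Z) (|Z|<width-middle (s ∸ m) s+m≤2n′))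
    where
    m≤s = <⇒≤ (≰⇒> s≰m)
    s+m≤2n′ : (m + (s ∸ m)) + m ≤ n + n
    s+m≤2n′ = subst (λ s → s + m ≤ n + n) (sym (m+[n∸m]≡n m≤s)) s+m≤2n

  blockedCount-low : ∀ s → s + m ≤ n + n → blockedCount s ≤ countLow s Z
  blockedCount-low zero    _ = ≤-trans blockedCount-0 (≤-trans (zCount≤levelSize 0) (levelSize-0 Z))
  blockedCount-low (suc s) s+1+m≤2n = begin
    blockedCount (suc s)                    ≤⟨ blockedCount-suc s ⟩
    zCount (suc s) + stuckCount s           ≤⟨ +-mono-≤ (zCount≤levelSize (suc s)) (stuckCount≤blockedCount c-reachable) ⟩
    levelSize (suc s) Z + blockedCount s    ≤⟨ +-monoʳ-≤ (levelSize (suc s) Z) ih ⟩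
    levelSize (suc s) Z + countLow s Z      ≤⟨ levelSize+countLow Z s ⟩
    countLow (suc s) Z                      ∎
    where
    open ≤-Reasoning
    s+m≤2n = ≤-trans (n≤1+n (s + m)) s+1+m≤2n
    ih = blockedCount-low s s+m≤2n
    c-reachable = proj₂ (reachable-on-level (≤-<-trans ih (countLow<width s s+m≤2n)))

  blockedCount-high : ∀ s → s ≤ n + n → blockedCount s + countHigh (suc s) Z + s ≤ n + n
  blockedCount-high s s≤2n with s + m ≤? n + n
  ... | yes s+m≤2n = begin
    blockedCount s + countHigh (suc s) Z + s ≤⟨ +-monoˡ-≤ s (+-monoˡ-≤ _ (blockedCount-low s s+m≤2n)) ⟩
    countLow s Z + countHigh (suc s) Z + s   ≤⟨ +-monoˡ-≤ s (countLow+countHigh Z s) ⟩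
    length Z + s                             ≤⟨ +-monoˡ-≤ s |Z|≤m ⟩
    m + s                                    ≡⟨ +-comm m s ⟩
    s + m                                    ≤⟨ s+m≤2n ⟩
    n + n                                    ∎
    where open ≤-Reasoning
  blockedCount-high zero    _     | no 0+m≰2n = ⊥-elim (0+m≰2n (≤-trans m≤n (m≤m+n n n)))
  blockedCount-high (suc s) s<2n | no s+1+m≰2n =
    ≤-trans (+-monoˡ-≤ (suc s) shrink) (∸1-step ih (countHigh≤ (suc s) s<2n))
    where
    open ≤-Reasoning
    top : n + n ≤ s + m
    top = s≤s⁻¹ (≰⇒> s+1+m≰2n)
    ih = blockedCount-high s (≤-trans (n≤1+n s) s<2n)
    shrink : blockedCount (suc s) + countHigh (suc (suc s)) Z ≤ (blockedCount s ∸ 1) + countHigh (suc s) Z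
    shrink = begin
      blockedCount (suc s) + countHigh (suc (suc s)) Z
        ≤⟨ +-monoˡ-≤ _ (≤-trans (blockedCount-suc s)
                                (+-mono-≤ (zCount≤levelSize (suc s)) (stuckCount-top m≤n top))) ⟩
      levelSize (suc s) Z + (blockedCount s ∸ 1) + countHigh (suc (suc s)) Z
        ≡⟨ xy∙z≈y∙xz (levelSize (suc s) Z) _ _ ⟩
      (blockedCount s ∸ 1) + (levelSize (suc s) Z + countHigh (suc (suc s)) Z)
        ≤⟨ +-monoʳ-≤ (blockedCount s ∸ 1) (levelSize+countHigh Z (suc s)) ⟩
      (blockedCount s ∸ 1) + countHigh (suc s) Z ∎

  corner-reachable : Reach (n + n) n
  corner-reachable = decidable-stable (reach? (n + n) n)
    λ ¬r → count≡0⇒none (blocked? (n + n)) nothing-blocked ≤-refl (corner , ¬r)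
    where
    corner : InLevel (n + n) n
    corner = m≤m+n n n , ≤-refl , ≤-refl , m≤m+n (n + n) m , m≤n+m (n + n) m
    nothing-blocked : blockedCount (n + n) ≡ 0
    nothing-blocked = n≤0⇒n≡0 (m+n≤o⇒m≤o _ (+-cancelʳ-≤ (n + n) _ 0 (blockedCount-high (n + n) ≤-refl)))

  path-to-corner : PathFromOrigin (n , n)
  path-to-corner = subst (λ j → PathFromOrigin (n , j)) (m+n∸n≡m n n) (Reach⇒PathFromOrigin corner-reachable)

-- + m / 1 is fromℚᵘ (mkℚᵘ (+ m) 0) by definition, which gets past its gcd normalisation.
cross-multiply : ∀ {m n} q → (+ m / 1) ≡ q *ℚ (+ n / 1) → + m ℤ.* ↧ q ≡ ↥ q ℤ.* + n
cross-multiply {m} {n} q@(mkℚ _ _ _) m≡qn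
  with ≃-trans (≃-sym (toℚᵘ-fromℚᵘ (mkℚᵘ (+ m) 0)))
         (≃-trans (≃-reflexive (cong toℚᵘ m≡qn))
           (≃-trans (toℚᵘ-homo-* q (+ n / 1)) (*-congˡ {toℚᵘ q} (toℚᵘ-fromℚᵘ (mkℚᵘ (+ n) 0)))))
... | *≡* eq = begin
    + m ℤ.* ↧ q                ≡⟨ cong (+ m ℤ.*_) (sym (ℤ.*-identityʳ (↧ q))) ⟩
    + m ℤ.* (↧ q ℤ.* + 1)      ≡⟨ eq ⟩
    (↥ q ℤ.* + n) ℤ.* + 1      ≡⟨ ℤ.*-identityʳ _ ⟩
    ↥ q ℤ.* + n                ∎
  where open ≡-Reasoning

ℕ-ratio-bounds : ∀ {m n} q → 0ℚ <ℚ q → q ≤ℚ 1ℚ → (+ m / 1) ≡ q *ℚ (+ n / 1) → m ≤ n × n ≤ m * ↧ₙ q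
ℕ-ratio-bounds (mkℚ -[1+ _ ] _ _) 0<q _ _ with () ← drop-*<* 0<q
ℕ-ratio-bounds {m} {n} q@(mkℚ (+ k) d _) 0<q q≤1 m≡qn =
  *-cancelʳ-≤ m n (suc d) (begin
    m * suc d   ≡⟨ md≡kn ⟩
    k * n       ≤⟨ *-monoˡ-≤ n k≤d ⟩
    suc d * n   ≡⟨ *-comm (suc d) n ⟩
    n * suc d   ∎) ,
  (begin
    n           ≡⟨ sym (*-identityˡ n) ⟩
    1 * n       ≤⟨ *-monoˡ-≤ n 1≤k ⟩
    k * n       ≡⟨ sym md≡kn ⟩
    m * suc d   ∎)
  where
  open ≤-Reasoning
  1≤k : 1 ≤ k
  1≤k = ≤-trans (drop‿+<+ (subst₂ ℤ._<_ (sym (pos-* 0 (suc d))) (sym (pos-* k 1)) (drop-*<* 0<q)))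
                (≤-reflexive (*-identityʳ k))
  k≤d : k ≤ suc d
  k≤d = subst₂ _≤_ (*-identityʳ k) (*-identityˡ (suc d))
          (drop‿+≤+ (subst₂ ℤ._≤_ (sym (pos-* k 1)) (sym (pos-* 1 (suc d))) (drop-*≤* q≤1)))
  md≡kn : m * suc d ≡ k * n
  md≡kn = ℤ.+-injective (trans (pos-* m (suc d)) (trans (cross-multiply {m} {n} q m≡qn) (sym (pos-* k n))))

-- The argument only needs ℓ ≥ 1 and 2ℓ ≤ m ≤ n, so ℓ₀ = 1 and δ = 1 suffice, and n₀ = 2ℓ · denominator(q)
-- makes m = qn ≥ 2ℓ.  Neither distinctness of Z nor Z ⊆ G(n;m) is used.
lemma2p7 : Σ ℕ λ ℓ₀ → (ℓ : ℕ) → ℓ₀ ≤ ℓ →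
    Σ ℚ λ δ → (0ℚ <ℚ δ) × ((q : ℚ) → 0ℚ <ℚ q → q ≤ℚ δ →
    Σ ℕ λ n₀ → (n : ℕ) → n₀ ≤ n → (m : ℕ) →
    (+ m / 1) ≡ q *ℚ (+ n / 1) →
    (Z : List Vertex) → Unique Z → All (InGrid n m) Z →
    10 * length Z ≤ m →
    ((i : ℕ) → 1 ≤ i → i * ℓ ≤ m →
      (countLow (i * ℓ) Z ≤ i ∸ 1) × (countHigh ((2 * n) ∸ (i * ℓ)) Z ≤ i ∸ 1)) →
    Σ (List Vertex) λ p → IsPathFromTo n m (0 , 0) (n , n) p × All (λ v → v ∉ Z) p)
lemma2p7 = 1 , λ ℓ 1≤ℓ → 1ℚ , positive⁻¹ 1ℚ , λ q 0<q q≤1 → (ℓ + ℓ) * ↧ₙ q ,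
  λ n n₀≤n m m≡qn Z _ _ G1 G2 →
    let m≤n , n≤m*d = ℕ-ratio-bounds q 0<q q≤1 m≡qn
        ℓ+ℓ≤m       = *-cancelʳ-≤ (ℓ + ℓ) m (↧ₙ q) (≤-trans n₀≤n n≤m*d)
    in CornerToCorner.path-to-corner {{>-nonZero 1≤ℓ}} m≤n ℓ+ℓ≤m G1 G2
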